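{- Each of the following triples $(c,\alpha,\beta)$ is a solution of the right fish equation: (1) $c(i,j)=t_iz_j+z_i$, $\alpha(i,j)=t_j$, $\beta(i,j)=-1$; (2) $c(i,j)=t_iz_j+z_i$, $\alpha(i,j)=z_j$, $\beta(i,j)=z_i$; (3) $c(i,j)=t_jz_i+z_j$, $\alpha(i,j)=(t_j+1)z_jt_i$, $\beta(i,j)=(t_i+1)z_i$; (4) $c(i,j)=t_jz_i+z_j$, $\alpha(i,j)=-(t_j+1)$, $\beta(i,j)=t_i+1$. Moreover, if $(c,\alpha_1,\beta_1)$ and $(c,\alpha_2,\beta_2)$ are solutions with the same $c$, then $(c,\lambda\alpha_1+\mu\alpha_2,\lambda\beta_1+\mu\beta_2)$ is a solution for all constants $\lambda,\mu\in\mathbb{C}$ (independent of $z_i,z_j,t_i,t_j$).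
   Context: Let $\alpha(i,j),\beta(i,j),c(i,j)$ denote expressions in complex variables $z_i,t_i,z_j,t_j$, and let $\alpha(j,i)$ denote the same expression with $(z_i,t_i)$ and $(z_j,t_j)$ interchanged (similarly for $\beta$). The triple $(c,\alpha,\beta)$ is a solution of the right fish equation if, identically in $z_i,z_j,t_i,t_j$, $$(t_i+1)z_i\,\beta(j,i)+(z_i-z_j)\,\alpha(j,i)=c(i,j)\,\beta(i,j),$$ $$(t_j+1)z_j\,\alpha(j,i)+(t_iz_j-t_jz_i)\,\beta(j,i)=c(i,j)\,\alpha(i,j).$$ -}

module Defs where

open import Algebra.Bundles using (CommutativeRing)
open import Data.Product using (_×_)
open import Level using (_⊔_)

-- The paper works over ℂ; ℂ is unavailable in agda-stdlib, so we work over an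
-- arbitrary commutative ring R (ℂ being one instance).
module Fish {a ℓ} (R : CommutativeRing a ℓ) where
  open CommutativeRing R

  -- An expression e(i,j) in the variables z_i, t_i, z_j, t_j,
  -- written  e zi ti zj tj.
  Expr : Set a
  Expr = Carrier → Carrier → Carrier → Carrier → Carrier

  -- The right fish equation, identically in zi, zj, ti, tj.
  -- e(j,i) is  e zj tj zi ti.
  IsRightFishSolution : Expr → Expr → Expr → Set (a ⊔ ℓ)
  IsRightFishSolution c α β = ∀ zi ti zj tj →
    ((ti + 1#) * zi * β zj tj zi ti + (zi + - zj) * α zj tj zi ti
        ≈ c zi ti zj tj * β zi ti zj tj)
    × ((tj + 1#) * zj * α zj tj zi ti + (ti * zj + - (tj * zi)) * β zj tj zi ti
        ≈ c zi ti zj tj * α zi ti zj tj)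

  lincomb : Carrier → Carrier → Expr → Expr → Expr
  lincomb l m e₁ e₂ zi ti zj tj = l * e₁ zi ti zj tj + m * e₂ zi ti zj tj

  c₁ α₁ β₁ : Expr
  c₁ zi ti zj tj = ti * zj + zi
  α₁ zi ti zj tj = tj
  β₁ zi ti zj tj = - 1#

  c₂ α₂ β₂ : Expr
  c₂ zi ti zj tj = ti * zj + zi
  α₂ zi ti zj tj = zj
  β₂ zi ti zj tj = zi

  c₃ α₃ β₃ : Expr
  c₃ zi ti zj tj = tj * zi + zj
  α₃ zi ti zj tj = (tj + 1#) * zj * ti
  β₃ zi ti zj tj = (ti + 1#) * zi

  c₄ α₄ β₄ : Expr
  c₄ zi ti zj tj = tj * zi + zj
  α₄ zi ti zj tj = - (tj + 1#)
  β₄ zi ti zj tj = ti + 1#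

{-# OPTIONS --safe #-}

-- For fixed c both right fish equations are linear and homogeneous in (α, β), so the
-- solutions with a common c are closed under linear combinations with constant
-- coefficients.  The four explicit solutions are polynomial identities in zi, ti, zj, tj
-- holding in every commutative ring; the ring solver checks them, reading its integer
-- coefficients into the ring through the canonical map ℤ → R.
module Submission where

open import Algebra.Bundles using (CommutativeRing)
open import Algebra.Solver.Ring.AlmostCommutativeRing
  using (AlmostCommutativeRing; fromCommutativeRing; _-Raw-AlmostCommutative⟶_)
open import Data.Integer.Base as ℤ using (ℤ; +_; -[1+_]; _⊖_; _◃_; sign; ∣_∣; +-*-rawRing)
open import Data.Integer.Properties using ([1+m]⊖[1+n]≡m⊖n; _≟_)
open import Data.Maybe.Base using (Maybe; just; nothing)
open import Data.Nat.Base as ℕ using (zero; suc)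
open import Data.Nat.Properties using (+-suc)
open import Data.Product.Base using (_×_; _,_)
open import Data.Sign.Base as Sign using (Sign)
open import Data.Vec.N-ary using (N-ary)
open import Relation.Binary.PropositionalEquality.Core as ≡ using (_≡_)
open import Relation.Nullary.Decidable.Core using (yes; no)
open import Defs

module FromInteger {a ℓ} (R : CommutativeRing a ℓ) where
  open CommutativeRing R
  open import Algebra.Properties.Ring ring
  -- With this version of _×_ the solver's constant con (+ 1) evaluates to 1# itself,
  -- so its normal-form proofs are refl on goals stated with 1#.
  open import Algebra.Properties.Semiring.Mult.TCOptimised semiring
    using (1+×; ×-homo-+; ×1-homo-*) renaming (_×_ to _·_)
  open import Relation.Binary.Reasoning.Setoid setoid

  fromℤ : ℤ → Carrier
  fromℤ (+ n)    = n · 1#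
  fromℤ -[1+ n ] = - (suc n · 1#)

  signed : Sign → Carrier → Carrier
  signed Sign.+ x = x
  signed Sign.- x = - x

  signed-cong : ∀ s {x y} → x ≈ y → signed s x ≈ signed s y
  signed-cong Sign.+ x≈y = x≈y
  signed-cong Sign.- x≈y = -‿cong x≈y

  signed-* : ∀ s t x y → signed (s Sign.* t) (x * y) ≈ signed s x * signed t y
  signed-* Sign.+ Sign.+ x y = refl
  signed-* Sign.+ Sign.- x y = -‿distribʳ-* x y
  signed-* Sign.- Sign.+ x y = -‿distribˡ-* x y
  signed-* Sign.- Sign.- x y = begin
    x * y       ≈⟨ -‿involutive (x * y) ⟨
    - - (x * y) ≈⟨ -‿cong (-‿distribʳ-* x y) ⟩
    - (x * - y) ≈⟨ -‿distribˡ-* x (- y) ⟩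
    - x * - y   ∎

  fromℤ-◃ : ∀ s n → fromℤ (s ◃ n) ≈ signed s (n · 1#)
  fromℤ-◃ Sign.+ zero    = refl
  fromℤ-◃ Sign.- zero    = sym -0#≈0#
  fromℤ-◃ Sign.+ (suc n) = refl
  fromℤ-◃ Sign.- (suc n) = refl

  fromℤ-sign-abs : ∀ i → fromℤ i ≡ signed (sign i) (∣ i ∣ · 1#)
  fromℤ-sign-abs (+ n)    = ≡.refl
  fromℤ-sign-abs -[1+ n ] = ≡.refl

  fromℤ-⊖ : ∀ m n → fromℤ (m ⊖ n) ≈ m · 1# - n · 1#
  fromℤ-⊖ m       zero    = sym (trans (+-congˡ -0#≈0#) (+-identityʳ _))
  fromℤ-⊖ zero    (suc n) = sym (+-identityˡ _)
  fromℤ-⊖ (suc m) (suc n) = begin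
    fromℤ (suc m ⊖ suc n)               ≡⟨ ≡.cong fromℤ ([1+m]⊖[1+n]≡m⊖n m n) ⟩
    fromℤ (m ⊖ n)                       ≈⟨ fromℤ-⊖ m n ⟩
    m · 1# - n · 1#                     ≈⟨ cancel-common-summand 1# (m · 1#) (n · 1#) ⟨
    (1# + m · 1#) - (1# + n · 1#)       ≈⟨ +-cong (1+× m 1#) (-‿cong (1+× n 1#)) ⟨
    suc m · 1# - suc n · 1#             ∎
    where
    cancel-common-summand : ∀ u x y → (u + x) - (u + y) ≈ x - y
    cancel-common-summand u x y = begin
      (u + x) + - (u + y)   ≈⟨ +-congˡ (-‿+-comm u y) ⟨
      (u + x) + (- u + - y) ≈⟨ +-assoc (u + x) (- u) (- y) ⟨
      (u + x + - u) + - y   ≈⟨ +-congʳ (xyx⁻¹≈y u x) ⟩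
      x + - y               ∎

  fromℤ-+ : ∀ i j → fromℤ (i ℤ.+ j) ≈ fromℤ i + fromℤ j
  fromℤ-+ (+ m)    (+ n)    = ×-homo-+ 1# m n
  fromℤ-+ (+ m)    -[1+ n ] = fromℤ-⊖ m (suc n)
  fromℤ-+ -[1+ m ] (+ n)    = trans (fromℤ-⊖ n (suc m)) (+-comm _ _)
  fromℤ-+ -[1+ m ] -[1+ n ] = begin
    - (suc (suc (m ℕ.+ n)) · 1#)        ≡⟨ ≡.cong (λ k → - (k · 1#)) (+-suc (suc m) n) ⟨
    - ((suc m ℕ.+ suc n) · 1#)          ≈⟨ -‿cong (×-homo-+ 1# (suc m) (suc n)) ⟩
    - (suc m · 1# + suc n · 1#)         ≈⟨ -‿+-comm _ _ ⟨
    - (suc m · 1#) + - (suc n · 1#)     ∎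

  fromℤ-* : ∀ i j → fromℤ (i ℤ.* j) ≈ fromℤ i * fromℤ j
  fromℤ-* i j = begin
    fromℤ (s ◃ ∣ i ∣ ℕ.* ∣ j ∣)                        ≈⟨ fromℤ-◃ s (∣ i ∣ ℕ.* ∣ j ∣) ⟩
    signed s ((∣ i ∣ ℕ.* ∣ j ∣) · 1#)                  ≈⟨ signed-cong s (×1-homo-* ∣ i ∣ ∣ j ∣) ⟩
    signed s ((∣ i ∣ · 1#) * (∣ j ∣ · 1#))             ≈⟨ signed-* (sign i) (sign j) _ _ ⟩
    signed (sign i) (∣ i ∣ · 1#) * signed (sign j) (∣ j ∣ · 1#) ≡⟨ ≡.cong₂ _*_ (fromℤ-sign-abs i) (fromℤ-sign-abs j) ⟨
    fromℤ i * fromℤ j                                  ∎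
    where s = sign i Sign.* sign j

  fromℤ-neg : ∀ i → fromℤ (ℤ.- i) ≈ - fromℤ i
  fromℤ-neg (+ zero)  = sym -0#≈0#
  fromℤ-neg (+ suc n) = refl
  fromℤ-neg -[1+ n ]  = sym (-‿involutive _)

  almostCommutativeRing : AlmostCommutativeRing a ℓ
  almostCommutativeRing = fromCommutativeRing R

  fromℤ-homomorphism : +-*-rawRing -Raw-AlmostCommutative⟶ almostCommutativeRing
  fromℤ-homomorphism = record
    { ⟦_⟧    = fromℤ
    ; +-homo = fromℤ-+
    ; *-homo = fromℤ-*
    ; -‿homo = fromℤ-neg
    ; 0-homo = refl
    ; 1-homo = refl
    }

  fromℤ-≟ : ∀ i j → Maybe (fromℤ i ≈ fromℤ j)
  fromℤ-≟ i j with i ≟ j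
  ... | yes ≡.refl = just refl
  ... | no _       = nothing

module RightFishSolutions {a ℓ} (R : CommutativeRing a ℓ) where
  open CommutativeRing R
  open Fish R
  open FromInteger R
  open import Algebra.Solver.Ring +-*-rawRing almostCommutativeRing fromℤ-homomorphism fromℤ-≟
  open import Relation.Binary.Reasoning.Setoid setoid

  Template : Set
  Template = Polynomial 4 → Polynomial 4 → Polynomial 4 → Polynomial 4 → Polynomial 4

  one : Polynomial 4
  one = con (+ 1)

  fishEquation₁ fishEquation₂ : (c α β : Template) → N-ary 4 (Polynomial 4) (Polynomial 4 × Polynomial 4)
  fishEquation₁ c α β zi ti zj tj =
    (ti :+ one) :* zi :* β zj tj zi ti :+ (zi :+ :- zj) :* α zj tj zi ti := c zi ti zj tj :* β zi ti zj tj
  fishEquation₂ c α β zi ti zj tj =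
    (tj :+ one) :* zj :* α zj tj zi ti :+ (ti :* zj :+ :- (tj :* zi)) :* β zj tj zi ti := c zi ti zj tj :* α zi ti zj tj

  solution₁ : IsRightFishSolution c₁ α₁ β₁
  solution₁ zi ti zj tj =
    solve 4 (fishEquation₁ c α β) refl zi ti zj tj , solve 4 (fishEquation₂ c α β) refl zi ti zj tj
    where
    c α β : Template
    c zi ti zj tj = ti :* zj :+ zi
    α zi ti zj tj = tj
    β zi ti zj tj = :- one

  solution₂ : IsRightFishSolution c₂ α₂ β₂
  solution₂ zi ti zj tj =
    solve 4 (fishEquation₁ c α β) refl zi ti zj tj , solve 4 (fishEquation₂ c α β) refl zi ti zj tj
    where
    c α β : Template
    c zi ti zj tj = ti :* zj :+ zi
    α zi ti zj tj = zj
    β zi ti zj tj = zi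

  solution₃ : IsRightFishSolution c₃ α₃ β₃
  solution₃ zi ti zj tj =
    solve 4 (fishEquation₁ c α β) refl zi ti zj tj , solve 4 (fishEquation₂ c α β) refl zi ti zj tj
    where
    c α β : Template
    c zi ti zj tj = tj :* zi :+ zj
    α zi ti zj tj = (tj :+ one) :* zj :* ti
    β zi ti zj tj = (ti :+ one) :* zi

  solution₄ : IsRightFishSolution c₄ α₄ β₄
  solution₄ zi ti zj tj =
    solve 4 (fishEquation₁ c α β) refl zi ti zj tj , solve 4 (fishEquation₂ c α β) refl zi ti zj tj
    where
    c α β : Template
    c zi ti zj tj = tj :* zi :+ zj
    α zi ti zj tj = :- (tj :+ one)
    β zi ti zj tj = ti :+ one

  linear-equation-lincomb : ∀ {p q r x₁ y₁ z₁ x₂ y₂ z₂} l m →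
    p * x₁ + q * y₁ ≈ r * z₁ → p * x₂ + q * y₂ ≈ r * z₂ →
    p * (l * x₁ + m * x₂) + q * (l * y₁ + m * y₂) ≈ r * (l * z₁ + m * z₂)
  linear-equation-lincomb {p} {q} {r} {x₁} {y₁} {z₁} {x₂} {y₂} {z₂} l m eq₁ eq₂ = begin
    p * (l * x₁ + m * x₂) + q * (l * y₁ + m * y₂)
      ≈⟨ solve 8 (λ p q l m x₁ y₁ x₂ y₂ →
           p :* (l :* x₁ :+ m :* x₂) :+ q :* (l :* y₁ :+ m :* y₂)
             := l :* (p :* x₁ :+ q :* y₁) :+ m :* (p :* x₂ :+ q :* y₂))
           refl p q l m x₁ y₁ x₂ y₂ ⟩
    l * (p * x₁ + q * y₁) + m * (p * x₂ + q * y₂)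
      ≈⟨ +-cong (*-congˡ eq₁) (*-congˡ eq₂) ⟩
    l * (r * z₁) + m * (r * z₂)
      ≈⟨ solve 5 (λ r l m z₁ z₂ → l :* (r :* z₁) :+ m :* (r :* z₂) := r :* (l :* z₁ :+ m :* z₂))
           refl r l m z₁ z₂ ⟩
    r * (l * z₁ + m * z₂)
      ∎

  lincomb-solution : ∀ {c α₁ β₁ α₂ β₂ : Expr} →
    IsRightFishSolution c α₁ β₁ → IsRightFishSolution c α₂ β₂ →
    ∀ l m → IsRightFishSolution c (lincomb l m α₁ α₂) (lincomb l m β₁ β₂)
  lincomb-solution sol₁ sol₂ l m zi ti zj tj
    with eq₁ , eq₁′ ← sol₁ zi ti zj tj | eq₂ , eq₂′ ← sol₂ zi ti zj tj
    = linear-equation-lincomb l m eq₁ eq₂ , linear-equation-lincomb l m eq₁′ eq₂′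

theorem6p1 : ∀ {a ℓ} (R : CommutativeRing a ℓ) → let open Fish R in
    IsRightFishSolution c₁ α₁ β₁
    × IsRightFishSolution c₂ α₂ β₂
    × IsRightFishSolution c₃ α₃ β₃
    × IsRightFishSolution c₄ α₄ β₄
    × (∀ (c a₁ b₁ a₂ b₂ : Expr) → IsRightFishSolution c a₁ b₁ → IsRightFishSolution c a₂ b₂ →
         ∀ (l m : CommutativeRing.Carrier R) → IsRightFishSolution c (lincomb l m a₁ a₂) (lincomb l m b₁ b₂))
theorem6p1 R =
  solution₁ , solution₂ , solution₃ , solution₄ , λ _ _ _ _ _ → lincomb-solution
  where open RightFishSolutions R
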